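{- Let $\mathcal{A}=(A,\to)$ be an ARS with a cofinal, acyclic, finite or infinite rewrite sequence $M: m_0\to m_1\to m_2\to\cdots$, and let $<$ be a well-order on $A$. Let $(A,\to_0,\to_1)$ be the two-label labelling defined below. Then: (i) ${\to}={\to_0}\cup{\to_1}$; (ii) for all $a,b\in M$ there is $e$ with $a\twoheadrightarrow_0 e$ and $b\twoheadrightarrow_0 e$; (iii) for every $a\in A$ there is at most one $b\in A$ with $a\to_0 b$; (iv) for every $a\notin M$ there exists $b\in A$ with $a\to_0 b$ and $\mathrm{d}(a)>\mathrm{d}(b)$; (v) for every $a\in A$ there exists $m\in M$ with $a\twoheadrightarrow_0 m$; (vi) with label order $0<1$, every peak $c\leftarrow_\beta a\rightarrow_\alpha b$ ($\alpha,\beta\in\{0,1\}$) can be joined, for some $d$, by $b \twoheadrightarrow_{<\alpha} \cdot \rightarrow_\beta^{\equiv} \cdot \twoheadrightarrow_{<\alpha \cup <\beta} d$ and $c \twoheadrightarrow_{<\beta} \cdot \rightarrow_\alpha^{\equiv} \cdot \twoheadrightarrow_{<\alpha\cup<\beta} d$.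
   Context: $\twoheadrightarrow$ denotes reflexive transitive closure. $a\in M$ means $a=m_i$ for some $i$; $(a\to b)\in M$ means $a=m_i$, $b=m_{i+1}$ for some $i$. $M$ is cofinal if every $a\in A$ satisfies $a\twoheadrightarrow m$ for some $m\in M$; acyclic means $m_i\neq m_j$ for $i\neq j$. The distance $\mathrm{d}(a)$ is the least $n\in\mathbb{N}$ with $a\to^n m$ for some $m\in M$. A step $a\to b$ is on the main road if $(a\to b)\in M$; it is minimising if $\mathrm{d}(a)=\mathrm{d}(b)+1$ and $b'\ge b$ (in the well-order) for every $b'$ with $a\to b'$ and $\mathrm{d}(b')=\mathrm{d}(b)$. Define $a\to_0 b$ iff $a\to b$ and this step is on the main road or minimising; $a\to_1 b$ iff $a\to b$ and this step is neither on the main road nor minimising. In (vi): ${\to_{<\gamma}}=\bigcup_{\delta<\gamma}{\to_\delta}$ (so $\to_{<0}=\emptyset$), ${\to_{<\alpha\cup<\beta}}={\to_{<\alpha}}\cup{\to_{<\beta}}$, $\twoheadrightarrow_X$ is the reflexive transitive closure of $\to_X$, and $\to^{\equiv}_\gamma$ is $\to_\gamma$ union identity. -}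

module Defs where

open import Level using (0ℓ)
open import Data.Nat using (ℕ; zero; suc; _≤_)
open import Data.Fin using (Fin; zero; suc) renaming (_<_ to _<ᶠ_)
open import Data.Maybe using (Maybe; just; nothing)
open import Data.Unit using (⊤)
open import Data.Product using (Σ; ∃; _×_; _,_)
open import Data.Sum using (_⊎_)
open import Relation.Binary.PropositionalEquality using (_≡_; _≢_)
open import Relation.Binary.Core using (Rel)
open import Relation.Binary.Structures using (IsStrictTotalOrder)
open import Induction.WellFounded using (WellFounded)
open import Relation.Nullary using (¬_)
open import Relation.Binary.Construct.Closure.ReflexiveTransitive using (Star)

record ARS : Set₁ where
  field
    A   : Set
    _⟶_ : Rel A 0ℓ

-- Index range of a rewrite sequence: 'nothing' = infinite sequence m₀ → m₁ → ⋯,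
-- 'just n' = finite sequence m₀ → ⋯ → mₙ.
InRange : Maybe ℕ → ℕ → Set
InRange nothing  i = ⊤
InRange (just n) i = i ≤ n

-- A (finite or infinite) rewrite sequence M : m₀ → m₁ → ⋯ in the ARS.
-- Values m i outside the range are irrelevant.
record RewSeq (𝒜 : ARS) : Set where
  open ARS 𝒜
  field
    len  : Maybe ℕ
    m    : ℕ → A
    step : ∀ i → InRange len (suc i) → m i ⟶ m (suc i)

module _ {𝒜 : ARS} where
  open ARS 𝒜

  data Steps : ℕ → A → A → Set where
    done : ∀ {a} → Steps zero a a
    _∷_  : ∀ {n a b c} → a ⟶ b → Steps n b c → Steps (suc n) a c

  module _ (M : RewSeq 𝒜) where
    open RewSeq M

    InM : A → Set
    InM a = ∃ λ i → InRange len i × a ≡ m i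

    OnMain : A → A → Set
    OnMain a b = ∃ λ i → InRange len (suc i) × a ≡ m i × b ≡ m (suc i)

    Cofinal : Set
    Cofinal = ∀ a → ∃ λ b → InM b × Star _⟶_ a b

    Acyclic : Set
    Acyclic = ∀ i j → InRange len i → InRange len j → i ≢ j → m i ≢ m j

    Dist : A → ℕ → Set
    Dist a n = (∃ λ b → InM b × Steps n a b)
             × (∀ k b → InM b → Steps k a b → n ≤ k)

    module _ (_<_ : Rel A 0ℓ) where

      Minimising : A → A → Set
      Minimising a b = ∃ λ n → Dist a (suc n) × Dist b n
                     × (∀ b' → a ⟶ b' → Dist b' n → b ≡ b' ⊎ b < b')

      Lab : Fin 2 → Rel A 0ℓ
      Lab zero       a b = a ⟶ b × (OnMain a b ⊎ Minimising a b)
      Lab (suc zero) a b = a ⟶ b × ¬ OnMain a b × ¬ Minimising a b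

      LabBelow : Fin 2 → Rel A 0ℓ
      LabBelow γ a b = ∃ λ δ → δ <ᶠ γ × Lab δ a b

      LabBelow2 : Fin 2 → Fin 2 → Rel A 0ℓ
      LabBelow2 α β a b = LabBelow α a b ⊎ LabBelow β a b

      LabRefl : Fin 2 → Rel A 0ℓ
      LabRefl γ a b = a ≡ b ⊎ Lab γ a b

IsWellOrder : {A : Set} → Rel A 0ℓ → Set
IsWellOrder _<_ = IsStrictTotalOrder _≡_ _<_ × WellFounded _<_

-- Let d(a) be the distance from a to the main road M. Every a off M has a successor at
-- distance d(a) − 1, and among those the <-least one is reached by the unique minimising
-- step; on M the unique →₀-step is the main-road step, by acyclicity. So →₀ is
-- deterministic, descends in d off M and runs along M on it, whence every element
-- →₀-reduces to M and any two elements are →₀-joinable. A peak with two 0-labels closes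
-- trivially by determinism; a peak involving the label 1 is closed by →₀-reductions alone,
-- which are then below one of the labels.
module Submission where

open import Defs
open import Level using (0ℓ)
open import Data.Nat using (ℕ; zero; suc; _≤_; s≤s; _+_; _∸_; _≟_) renaming (_<_ to _<ℕ_)
open import Data.Nat.Properties using (≤-trans; n≤1+n; ≮⇒≥; ≤-antisym; ≤-total; m∸n+n≡m; n<1+n; 0<1+n; suc-injective)
open import Data.Nat.Induction using (<-wellFounded)
open import Data.Fin using (Fin; zero; suc)
open import Data.Product using (∃; _×_; _,_; proj₁; proj₂)
open import Data.Sum using (_⊎_; inj₁; inj₂)
open import Data.Empty using (⊥-elim)
open import Data.Unit using (tt)
open import Data.Maybe using (just; nothing)
open import Relation.Nullary using (¬_; yes; no)
open import Relation.Binary.Core using (Rel)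
open import Relation.Binary.Definitions using (tri<; tri≈; tri>)
open import Relation.Binary.Structures using (IsStrictTotalOrder)
open import Relation.Binary.PropositionalEquality using (_≡_; refl; sym; trans; subst)
open import Relation.Binary.Construct.Closure.ReflexiveTransitive using (Star; ε; _◅_; _◅◅_) renaming (map to Star-map)
open import Induction.WellFounded using (WellFounded; Acc; acc)
open import Axiom.ExcludedMiddle using (ExcludedMiddle)

module _ (em : ExcludedMiddle 0ℓ) {X : Set} {_≺_ : Rel X 0ℓ} (wf : WellFounded _≺_) where

  ∃-minimal : ∀ {P : X → Set} {x} → P x → ∃ λ y → P y × (∀ z → z ≺ y → ¬ P z)
  ∃-minimal {P} {x} = go x (wf x)
    where
    go : ∀ x → Acc _≺_ x → P x → ∃ λ y → P y × (∀ z → z ≺ y → ¬ P z)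
    go x (acc rs) px with em {∃ λ z → z ≺ x × P z}
    ... | yes (z , z≺x , pz) = go z (rs z≺x) pz
    ... | no ¬smaller = x , px , λ z z≺x pz → ¬smaller (z , z≺x , pz)

Star⇒Steps : ∀ {𝒜 : ARS} {a b} → Star (ARS._⟶_ 𝒜) a b → ∃ λ n → Steps {𝒜} n a b
Star⇒Steps ε = zero , done
Star⇒Steps (s ◅ ss) with Star⇒Steps ss
... | n , st = suc n , (s ∷ st)

module Labelling (𝒜 : ARS) (M : RewSeq 𝒜) (_<_ : Rel (ARS.A 𝒜) 0ℓ)
  (em : ExcludedMiddle 0ℓ) (cofinal : Cofinal M) (acyclic : Acyclic M) (wo : IsWellOrder _<_) where

  open ARS 𝒜
  open RewSeq M
  open IsStrictTotalOrder (proj₁ wo) using (compare; irrefl) renaming (trans to <-trans)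

  _⟶₀_ : Rel A 0ℓ
  _⟶₀_ = Lab M _<_ zero

  _⟶₁_ : Rel A 0ℓ
  _⟶₁_ = Lab M _<_ (suc zero)

  InRange-pred : ∀ i → InRange len (suc i) → InRange len i
  InRange-pred i r with len
  ... | nothing = tt
  ... | just n  = ≤-trans (n≤1+n i) r

  OnMain⇒InM : ∀ {a b} → OnMain M a b → InM M a
  OnMain⇒InM (i , r , a≡mᵢ , _) = i , InRange-pred i r , a≡mᵢ

  Dist-exists : ∀ a → ∃ λ n → Dist M a n
  Dist-exists a with cofinal a
  ... | b , b∈M , a↠b with Star⇒Steps a↠b
  ... | k , a→ᵏb with ∃-minimal em <-wellFounded {P = λ n → ∃ λ b → InM M b × Steps n a b} (b , b∈M , a→ᵏb)
  ... | n , reach , least = n , reach , λ j b' b'∈M a→ʲb' → ≮⇒≥ (λ j<n → least j j<n (b' , b'∈M , a→ʲb'))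

  Dist-unique : ∀ {a n n'} → Dist M a n → Dist M a n' → n ≡ n'
  Dist-unique ((b , b∈M , a→ⁿb) , least) ((b' , b'∈M , a→ⁿ'b') , least') =
    ≤-antisym (least _ b' b'∈M a→ⁿ'b') (least' _ b b∈M a→ⁿb)

  InM⇒Dist-zero : ∀ {a n} → InM M a → Dist M a n → n ≡ zero
  InM⇒Dist-zero a∈M (_ , least) = ≤-antisym (least zero _ a∈M done) (≮⇒≥ λ ())

  Dist-zero⇒InM : ∀ {a} → Dist M a zero → InM M a
  Dist-zero⇒InM ((_ , b∈M , done) , _) = b∈M

  InM⇒¬Minimising : ∀ {a b} → InM M a → ¬ Minimising M _<_ a b
  InM⇒¬Minimising a∈M (n , Da , _) with InM⇒Dist-zero a∈M Da
  ... | ()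

  minimising-successor : ∀ {a n} → Dist M a (suc n) → ∃ λ b → a ⟶ b × Minimising M _<_ a b × Dist M b n
  minimising-successor {a} {n} Da@((m' , m'∈M , (a→b ∷ b→ⁿm')) , least)
    with ∃-minimal em (proj₂ wo) {P = λ b → a ⟶ b × Dist M b n}
           (a→b , (m' , m'∈M , b→ⁿm') , λ k c c∈M b→ᵏc → pred-≤ (least (suc k) c c∈M (a→b ∷ b→ᵏc)))
    where pred-≤ : ∀ {x y} → suc x ≤ suc y → x ≤ y
          pred-≤ (s≤s p) = p
  ... | b , (a→b' , Db) , least-b = b , a→b' , (n , Da , Db , <-least) , Db
    where
    <-least : ∀ b' → a ⟶ b' → Dist M b' n → b ≡ b' ⊎ b < b'
    <-least b' a→b' Db' with compare b b'
    ... | tri< b<b' _ _ = inj₂ b<b'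
    ... | tri≈ _ b≡b' _ = inj₁ b≡b'
    ... | tri> _ _ b'<b = ⊥-elim (least-b b' b'<b (a→b' , Db'))

  ⟶-split : ∀ {a b} → a ⟶ b → a ⟶₀ b ⊎ a ⟶₁ b
  ⟶-split {a} {b} a→b with em {OnMain M a b ⊎ Minimising M _<_ a b}
  ... | yes label0 = inj₁ (a→b , label0)
  ... | no ¬label0 = inj₂ (a→b , (λ o → ¬label0 (inj₁ o)) , (λ o → ¬label0 (inj₂ o)))

  ⟶₀∪⟶₁⇒⟶ : ∀ {a b} → a ⟶₀ b ⊎ a ⟶₁ b → a ⟶ b
  ⟶₀∪⟶₁⇒⟶ (inj₁ (a→b , _)) = a→b
  ⟶₀∪⟶₁⇒⟶ (inj₂ (a→b , _)) = a→b

  ⟶₀-deterministic : ∀ {a b b'} → a ⟶₀ b → a ⟶₀ b' → b ≡ b'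
  ⟶₀-deterministic (_ , inj₁ (i , rᵢ , a≡mᵢ , b≡mᵢ₊₁)) (_ , inj₁ (j , rⱼ , a≡mⱼ , b'≡mⱼ₊₁)) with i ≟ j
  ... | yes refl = trans b≡mᵢ₊₁ (sym b'≡mⱼ₊₁)
  ... | no i≢j = ⊥-elim (acyclic i j (InRange-pred i rᵢ) (InRange-pred j rⱼ) i≢j (trans (sym a≡mᵢ) a≡mⱼ))
  ⟶₀-deterministic (_ , inj₁ main) (_ , inj₂ mini) = ⊥-elim (InM⇒¬Minimising (OnMain⇒InM main) mini)
  ⟶₀-deterministic (_ , inj₂ mini) (_ , inj₁ main) = ⊥-elim (InM⇒¬Minimising (OnMain⇒InM main) mini)
  ⟶₀-deterministic (a→b , inj₂ (n , Da , Db , least)) (a→b' , inj₂ (n' , Da' , Db' , least'))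
    with suc-injective (Dist-unique Da Da')
  ... | refl with least _ a→b' Db' | least' _ a→b Db
  ... | inj₁ b≡b' | _         = b≡b'
  ... | inj₂ _    | inj₁ b'≡b = sym b'≡b
  ... | inj₂ b<b' | inj₂ b'<b = ⊥-elim (irrefl refl (<-trans b<b' b'<b))

  ¬InM⇒⟶₀-descent : ∀ a → ¬ InM M a → ∃ λ b → a ⟶₀ b
                      × ∃ λ da → ∃ λ db → Dist M a da × Dist M b db × db <ℕ da
  ¬InM⇒⟶₀-descent a a∉M with Dist-exists a
  ... | zero , Da = ⊥-elim (a∉M (Dist-zero⇒InM Da))
  ... | suc n , Da with minimising-successor Da
  ... | b , a→b , mini , Db = b , (a→b , inj₂ mini) , suc n , n , Da , Db , n<1+n n

  main-road-⟶₀* : ∀ k i → InRange len (k + i) → Star _⟶₀_ (m i) (m (k + i))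
  main-road-⟶₀* zero    i r = ε
  main-road-⟶₀* (suc k) i r =
    main-road-⟶₀* k i (InRange-pred (k + i) r) ◅◅ ((step (k + i) r , inj₁ (k + i , r , refl , refl)) ◅ ε)

  main-road-⟶₀*-≤ : ∀ {i j} → i ≤ j → InRange len j → Star _⟶₀_ (m i) (m j)
  main-road-⟶₀*-≤ {i} {j} i≤j r = subst (λ x → Star _⟶₀_ (m i) (m x)) (m∸n+n≡m i≤j)
    (main-road-⟶₀* (j ∸ i) i (subst (InRange len) (sym (m∸n+n≡m i≤j)) r))

  InM-⟶₀-joinable : ∀ a b → InM M a → InM M b → ∃ λ e → Star _⟶₀_ a e × Star _⟶₀_ b e
  InM-⟶₀-joinable _ _ (i , rᵢ , refl) (j , rⱼ , refl) with ≤-total i j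
  ... | inj₁ i≤j = m j , main-road-⟶₀*-≤ i≤j rⱼ , ε
  ... | inj₂ j≤i = m i , ε , main-road-⟶₀*-≤ j≤i rᵢ

  ⟶₀*-reaches-M : ∀ a → ∃ λ m → InM M m × Star _⟶₀_ a m
  ⟶₀*-reaches-M a with Dist-exists a
  ... | n , Da = go n (<-wellFounded n) a Da
    where
    go : ∀ n → Acc _<ℕ_ n → ∀ a → Dist M a n → ∃ λ m → InM M m × Star _⟶₀_ a m
    go n (acc rs) a Da with em {InM M a}
    ... | yes a∈M = a , a∈M , ε
    ... | no a∉M with ¬InM⇒⟶₀-descent a a∉M
    ... | b , a→₀b , _ , db , Da' , Db , db<da with Dist-unique Da Da'
    ... | refl with go db (rs db<da) b Db
    ... | m' , m'∈M , b↠₀m' = m' , m'∈M , (a→₀b ◅ b↠₀m')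

  ⟶₀-joinable : ∀ b c → ∃ λ d → Star _⟶₀_ b d × Star _⟶₀_ c d
  ⟶₀-joinable b c with ⟶₀*-reaches-M b | ⟶₀*-reaches-M c
  ... | mb , mb∈M , b↠mb | mc , mc∈M , c↠mc with InM-⟶₀-joinable mb mc mb∈M mc∈M
  ... | e , mb↠e , mc↠e = e , b↠mb ◅◅ mb↠e , c↠mc ◅◅ mc↠e

  DecreasingJoin : Fin 2 → Fin 2 → A → A → Set
  DecreasingJoin α β b c = ∃ λ d →
      (∃ λ b₁ → ∃ λ b₂ → Star (LabBelow M _<_ α) b b₁
         × LabRefl M _<_ β b₁ b₂ × Star (LabBelow2 M _<_ α β) b₂ d)
    × (∃ λ c₁ → ∃ λ c₂ → Star (LabBelow M _<_ β) c c₁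
         × LabRefl M _<_ α c₁ c₂ × Star (LabBelow2 M _<_ α β) c₂ d)

  DecreasingJoin-refl : ∀ α β b → DecreasingJoin α β b b
  DecreasingJoin-refl α β b = b , (b , b , ε , inj₁ refl , ε) , (b , b , ε , inj₁ refl , ε)

  ⟶₀-join⇒DecreasingJoin : ∀ α β → (∀ {x y} → x ⟶₀ y → LabBelow2 M _<_ α β x y) →
                            ∀ b c → DecreasingJoin α β b c
  ⟶₀-join⇒DecreasingJoin α β ⟶₀⊆below b c with ⟶₀-joinable b c
  ... | d , b↠d , c↠d =
    d , (b , b , ε , inj₁ refl , Star-map ⟶₀⊆below b↠d) , (c , c , ε , inj₁ refl , Star-map ⟶₀⊆below c↠d)

  peak-DecreasingJoin : ∀ α β {a b c} → Lab M _<_ α a b → Lab M _<_ β a c → DecreasingJoin α β b c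
  peak-DecreasingJoin zero zero a→₀b a→₀c with ⟶₀-deterministic a→₀b a→₀c
  ... | refl = DecreasingJoin-refl zero zero _
  peak-DecreasingJoin (suc zero) β _ _ =
    ⟶₀-join⇒DecreasingJoin (suc zero) β (λ x→₀y → inj₁ (zero , 0<1+n , x→₀y)) _ _
  peak-DecreasingJoin zero (suc zero) _ _ =
    ⟶₀-join⇒DecreasingJoin zero (suc zero) (λ x→₀y → inj₂ (zero , 0<1+n , x→₀y)) _ _

lemma4p9 : (𝒜 : ARS) (M : RewSeq 𝒜) (_<_ : Rel (ARS.A 𝒜) 0ℓ) →
  ExcludedMiddle 0ℓ →
  Cofinal M → Acyclic M → IsWellOrder _<_ →
  let open ARS 𝒜
      _⟶₀_ = Lab M _<_ zero
      _⟶₁_ = Lab M _<_ (suc zero)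
  in
  -- (i)
  (∀ a b → ((a ⟶ b) → (a ⟶₀ b ⊎ a ⟶₁ b)) × ((a ⟶₀ b ⊎ a ⟶₁ b) → (a ⟶ b)))
  -- (ii)
  × (∀ a b → InM M a → InM M b → ∃ λ e → Star _⟶₀_ a e × Star _⟶₀_ b e)
  -- (iii)
  × (∀ a b b' → a ⟶₀ b → a ⟶₀ b' → b ≡ b')
  -- (iv)
  × (∀ a → ¬ InM M a → ∃ λ b → a ⟶₀ b
       × ∃ λ da → ∃ λ db → Dist M a da × Dist M b db × db <ℕ da)
  -- (v)
  × (∀ a → ∃ λ m → InM M m × Star _⟶₀_ a m)
  -- (vi)
  × (∀ (α β : Fin 2) a b c → Lab M _<_ α a b → Lab M _<_ β a c →
       ∃ λ d →
         (∃ λ b₁ → ∃ λ b₂ → Star (LabBelow M _<_ α) b b₁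
            × LabRefl M _<_ β b₁ b₂ × Star (LabBelow2 M _<_ α β) b₂ d)
       × (∃ λ c₁ → ∃ λ c₂ → Star (LabBelow M _<_ β) c c₁
            × LabRefl M _<_ α c₁ c₂ × Star (LabBelow2 M _<_ α β) c₂ d))
lemma4p9 𝒜 M _<_ em cofinal acyclic wo =
    (λ _ _ → ⟶-split , ⟶₀∪⟶₁⇒⟶)
  , InM-⟶₀-joinable
  , (λ _ _ _ → ⟶₀-deterministic)
  , ¬InM⇒⟶₀-descent
  , ⟶₀*-reaches-M
  , (λ α β _ _ _ → peak-DecreasingJoin α β)
  where open Labelling 𝒜 M _<_ em cofinal acyclic wo
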